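{- Let $k$ be a positive integer and let $\sigma\in\mathrm{SIM}(X)$ have disjoint path and cycle decomposition $\sigma=\sigma_1\sigma_2\cdots\sigma_n$ consisting of $n$ paths (no cycles) all of the same length $\ell(\sigma_1)=\cdots=\ell(\sigma_n)>1$. Then $\sigma$ has a $k$th root if and only if $k$ divides $n$, and if $k\mid n$, then $\sigma$ has exactly $n!/(n/k)!$ $k$th roots.
   Context: For a finite set $X$, $\mathrm{SIM}(X)$ is the symmetric inverse monoid: the set of all partial one-to-one maps from $X$ to itself, under composition. For distinct $a_1,\dots,a_\ell$, the path $[a_1a_2\cdots a_\ell]$ is the partial map sending $a_i\mapsto a_{i+1}$ for $i<\ell$ and undefined at $a_\ell$ (so $[a]$ is the nowhere-defined map on $\{a\}$); the cycle $(a_1\cdots a_\ell)$ sends $a_i\mapsto a_{i+1}$ for $i<\ell$ and $a_\ell\mapsto a_1$. Its length is $\ell$ and $a_1,\dots,a_\ell$ are its digits. Paths/cycles are disjoint if their digit sets are disjoint, and a product of disjoint paths/cycles is the partial map on the union of their digits agreeing with each one on its digits. Every element of $\mathrm{SIM}(X)$ is uniquely a product of disjoint paths and cycles whose digit sets partition $X$ (its disjoint path and cycle decomposition, length-one paths and cycles included). A $k$th root of $\sigma$ is $\alpha\in\mathrm{SIM}(X)$ with $\alpha^k=\sigma$. -}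

module Defs where

open import Data.Nat using (ℕ; zero; suc; _<_)
open import Data.Fin using (Fin; toℕ) renaming (suc to fsuc)
open import Data.Fin.Properties using ()
open import Data.Maybe using (Maybe; just; nothing; _>>=_)
open import Data.Vec using (Vec; lookup)
open import Data.Product using (_×_; ∃-syntax)
open import Relation.Binary.PropositionalEquality using (_≡_)

-- A partial map on X = Fin m, stored as its table of values
-- (nothing = undefined at that point).
PMap : ℕ → Set
PMap m = Vec (Maybe (Fin m)) m

app : ∀ {m} → PMap m → Fin m → Maybe (Fin m)
app α x = lookup α x

IsPartialInjective : ∀ {m} → PMap m → Set
IsPartialInjective {m} α =
  ∀ (x y z : Fin m) → app α x ≡ just z → app α y ≡ just z → x ≡ y

IsSIM : ∀ {m} → PMap m → Set
IsSIM = IsPartialInjective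

-- Composition (α ∘ β)(x) = α(β(x)); for powers the order is irrelevant.
infixr 9 _∘ₚ_
_∘ₚ_ : ∀ {m} → PMap m → PMap m → PMap m
_∘ₚ_ {m} α β = Data.Vec.tabulate (λ x → app β x >>= app α)

idₚ : ∀ {m} → PMap m
idₚ = Data.Vec.tabulate just

_^ₚ_ : ∀ {m} → PMap m → ℕ → PMap m
α ^ₚ zero = idₚ
α ^ₚ suc k = α ∘ₚ (α ^ₚ k)

IsRoot : ∀ {m} → ℕ → PMap m → PMap m → Set
IsRoot k σ α = IsSIM α × (α ^ₚ k ≡ σ)

nextPos : ∀ {ℓ} → Fin ℓ → Maybe (Fin ℓ)
nextPos {suc zero} Fin.zero = nothing
nextPos {suc (suc ℓ)} Fin.zero = just (fsuc Fin.zero)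
nextPos {suc (suc ℓ)} (fsuc j) = Data.Maybe.map fsuc (nextPos j)

-- σ has disjoint path and cycle decomposition consisting exactly of n paths
-- [p i 0, p i 1, …, p i (ℓ-1)] (i < n), each of length ℓ, and no cycles:
-- the digit sets of the paths are pairwise disjoint and partition X (the map
-- (i , j) ↦ p i j is a bijection Fin n × Fin ℓ → Fin m), and σ is the
-- product of these paths.
IsProductOfPaths : ∀ {m} (n ℓ : ℕ) → PMap m → (Fin n → Fin ℓ → Fin m) → Set
IsProductOfPaths {m} n ℓ σ p =
    (∀ i j i′ j′ → p i j ≡ p i′ j′ → (i ≡ i′ × j ≡ j′))
  × (∀ (x : Fin m) → ∃[ i ] ∃[ j ] (p i j ≡ x))
  × (∀ i j → app σ (p i j) ≡ Data.Maybe.map (p i) (nextPos j))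

module Submission where

-- Let σ be the product of n disjoint paths p i 0 → p i 1 → ⋯ → p i (ℓ-1) with
-- ℓ ≥ 2, and let k ≥ 1.  A k-th root α commutes with σ = α^k and is defined at
-- every path start, hence maps each path, shifted, into a single path:
-- α (p i j) = p (τ i) (j + ε i).  So roots correspond bijectively to
-- configurations (τ , ε) in which every path comes back to itself after k
-- steps of τ with total offset 1 ("full" configurations): τ is a permutation
-- whose cycles all have length exactly k, each cycle carrying a single offset 1.
-- Full configurations are enumerated without repetition by choosing, for the
-- first remaining path, the other k-1 paths of its cycle in order and the
-- place of the offset 1, then recursing on the rest.  Their number count n n
-- is nonzero only if k ∣ n, and equals n!/(n/k)! when k ∣ n.

open import Defs
open import Data.Nat using (ℕ; NonZero; _<_; _!)
open import Data.Nat.Properties using (_!≢0)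
open import Data.Nat.DivMod using (_/_)
open import Data.Nat.Divisibility using (_∣_)
open import Data.Fin using (Fin)
open import Data.List using (List; length)
open import Data.List.Membership.Propositional using (_∈_)
open import Data.List.Relation.Unary.Unique.Propositional using (Unique)
open import Data.Product using (_×_; Σ; ∃-syntax)
open import Function.Bundles using (_⇔_)
open import Relation.Binary.PropositionalEquality using (_≡_)

open import Data.Nat using (zero; suc; _+_; _*_; _∸_; _≤_; z≤n; s≤s; ≢-nonZero⁻¹)
open import Data.Nat.Properties
open import Data.Nat.ListAction using (sum)
open import Data.Nat.DivMod using (m*n/n≡m; /-congˡ)
open import Data.Nat.Divisibility using (divides; _∣0; ∣m∣n⇒∣m+n; ∣-refl)
open import Data.Nat.Tactic.RingSolver using (solve-∀)
open import Data.Fin using (toℕ) renaming (zero to fzero; suc to fsuc; _≟_ to _≟ᶠ_)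
open import Data.Fin.Properties using (toℕ-injective; toℕ<n)
open import Data.Maybe using (Maybe; just; nothing; _>>=_)
open import Data.Maybe.Properties using (just-injective)
import Data.Maybe as Maybe
open import Data.Vec using (Vec; lookup; _[_]≔_; tabulate)
open import Data.Vec.Properties using (lookup∘update; lookup∘update′; lookup∘tabulate; tabulate∘lookup; tabulate-cong)
open import Data.List using ([]; _∷_; _++_; map; filter; replicate; allFin)
open import Data.List.Properties using (length-++; length-map; length-replicate; length-tabulate; ∷-injective; ∷-injectiveʳ; filter-all)
open import Data.List.Membership.Propositional using (_∉_)
open import Data.List.Membership.Propositional.Properties using (∈-map⁺; ∈-map⁻; ∈-++⁺ˡ; ∈-++⁺ʳ; ∈-++⁻; ∈-filter⁺; ∈-filter⁻; ∈-allFin)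
open import Data.List.Relation.Unary.Any using (here; there)
open import Data.List.Relation.Unary.All as All using (All; []; _∷_)
open import Data.List.Relation.Unary.Unique.Propositional using ([]; _∷_)
open import Data.List.Relation.Unary.Unique.Propositional.Properties using (map⁺; ++⁺; filter⁺; allFin⁺)
open import Data.List.Relation.Binary.Disjoint.Propositional using (Disjoint)
open import Data.Product using (_,_; proj₁; proj₂; uncurry)
open import Data.Product.Properties using (,-injectiveʳ)
open import Data.Sum using (inj₁; inj₂)
open import Data.Empty using (⊥; ⊥-elim)
open import Function.Bundles using (mk⇔)
open import Relation.Nullary using (yes; no; ¬?)
open import Relation.Binary.Definitions using (DecidableEquality)
open import Relation.Binary.PropositionalEquality using (refl; sym; trans; cong; cong₂; subst; _≢_; module ≡-Reasoning)

map-unique : ∀ {A B : Set} (f : A → B) (xs : List A) → Unique xs →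
  (∀ x y → x ∈ xs → y ∈ xs → f x ≡ f y → x ≡ y) → Unique (map f xs)
map-unique f [] [] inj = []
map-unique f (x ∷ xs) (x∉ ∷ u) inj =
  All.tabulate (λ z∈ eq → let (y , y∈ , z≡) = ∈-map⁻ f z∈ in
                  All.lookup x∉ y∈ (inj x y (here refl) (there y∈) (trans eq z≡)))
  ∷ map-unique f xs u (λ a b a∈ b∈ → inj a b (there a∈) (there b∈))

member⇒length≢0 : ∀ {A : Set} {x : A} (xs : List A) → x ∈ xs → length xs ≢ 0
member⇒length≢0 (_ ∷ _) _ ()

length≢0⇒member : ∀ {A : Set} (xs : List A) → length xs ≢ 0 → ∃[ x ] (x ∈ xs)
length≢0⇒member [] nz = ⊥-elim (nz refl)
length≢0⇒member (x ∷ xs) nz = x , here refl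

module _ {A B : Set} where

  pairs : List A → (A → List B) → List (A × B)
  pairs [] f = []
  pairs (x ∷ xs) f = map (x ,_) (f x) ++ pairs xs f

  ∈-pairs⁺ : ∀ {xs f x y} → x ∈ xs → y ∈ f x → (x , y) ∈ pairs xs f
  ∈-pairs⁺ {z ∷ xs} {f} (here refl) y∈ = ∈-++⁺ˡ (∈-map⁺ (z ,_) y∈)
  ∈-pairs⁺ {z ∷ xs} {f} (there x∈) y∈ = ∈-++⁺ʳ (map (z ,_) (f z)) (∈-pairs⁺ x∈ y∈)

  ∈-pairs⁻ : ∀ xs f {x y} → (x , y) ∈ pairs xs f → x ∈ xs × y ∈ f x
  ∈-pairs⁻ (z ∷ xs) f m with ∈-++⁻ (map (z ,_) (f z)) m
  ... | inj₂ m′ = let (x∈ , y∈) = ∈-pairs⁻ xs f m′ in there x∈ , y∈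
  ... | inj₁ m′ with ∈-map⁻ (z ,_) m′
  ...   | (y , y∈ , refl) = here refl , y∈

  pairs-unique : ∀ {xs} f → Unique xs → (∀ x → Unique (f x)) → Unique (pairs xs f)
  pairs-unique {[]} f [] uf = []
  pairs-unique {z ∷ xs} f (z∉ ∷ u) uf =
    ++⁺ (map⁺ ,-injectiveʳ (uf z)) (pairs-unique f u uf) disjoint
    where
    disjoint : Disjoint (map (z ,_) (f z)) (pairs xs f)
    disjoint (m₁ , m₂) with ∈-map⁻ (z ,_) m₁
    ... | (_ , _ , refl) = All.lookup z∉ (proj₁ (∈-pairs⁻ xs f m₂)) refl

  length-pairs : ∀ xs f (C : ℕ) → (∀ x → x ∈ xs → length (f x) ≡ C) →
    length (pairs xs f) ≡ length xs * C
  length-pairs [] f C h = refl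
  length-pairs (x ∷ xs) f C h = begin
    length (map (x ,_) (f x) ++ pairs xs f)        ≡⟨ length-++ (map (x ,_) (f x)) ⟩
    length (map (x ,_) (f x)) + length (pairs xs f) ≡⟨ cong₂ _+_ (length-map (x ,_) (f x))
                                                        (length-pairs xs f C (λ y y∈ → h y (there y∈))) ⟩
    length (f x) + length xs * C                    ≡⟨ cong (_+ length xs * C) (h x (here refl)) ⟩
    C + length xs * C                               ∎
    where open ≡-Reasoning

falling : ℕ → ℕ → ℕ
falling M zero = 1
falling M (suc j) = M * falling (M ∸ 1) j

falling-! : ∀ a j → falling (a + j) j * a ! ≡ (a + j) !
falling-! a zero = trans (+-identityʳ (a !)) (cong _! (sym (+-identityʳ a)))
falling-! a (suc j) rewrite +-suc a j =
  trans (*-assoc (suc (a + j)) (falling (a + j) j) (a !)) (cong (suc (a + j) *_) (falling-! a j))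

falling≢0⇒≤ : ∀ M j → falling M j ≢ 0 → j ≤ M
falling≢0⇒≤ M zero nz = z≤n
falling≢0⇒≤ zero (suc j) nz = ⊥-elim (nz refl)
falling≢0⇒≤ (suc M) (suc j) nz =
  s≤s (falling≢0⇒≤ M j (λ e → nz (trans (cong (suc M *_) e) (*-zeroʳ (suc M)))))

module Arrangements {A : Set} (_≟_ : DecidableEquality A) where

  _∖ₑ_ : List A → A → List A
  L ∖ₑ y = filter (λ z → ¬? (z ≟ y)) L

  _∖_ : List A → List A → List A
  L ∖ [] = L
  L ∖ (y ∷ a) = (L ∖ₑ y) ∖ a

  ∈-∖ₑ⁻ : ∀ L y {z} → z ∈ L ∖ₑ y → z ∈ L × z ≢ y
  ∈-∖ₑ⁻ L y m = ∈-filter⁻ (λ z → ¬? (z ≟ y)) m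

  ∈-∖ₑ⁺ : ∀ L y {z} → z ∈ L → z ≢ y → z ∈ L ∖ₑ y
  ∈-∖ₑ⁺ L y m ne = ∈-filter⁺ (λ z → ¬? (z ≟ y)) m ne

  ∖ₑ-unique : ∀ L y → Unique L → Unique (L ∖ₑ y)
  ∖ₑ-unique L y u = filter⁺ (λ z → ¬? (z ≟ y)) u

  length-∖ₑ : ∀ L y → Unique L → y ∈ L → suc (length (L ∖ₑ y)) ≡ length L
  length-∖ₑ (z ∷ L) y (z∉ ∷ u) y∈ with z ≟ y
  ... | yes refl = cong suc (cong length (filter-all (λ w → ¬? (w ≟ y)) (All.map (λ ne e → ne (sym e)) z∉)))
  ... | no z≢y with y∈
  ...   | here e = ⊥-elim (z≢y (sym e))
  ...   | there m = cong suc (length-∖ₑ L y u m)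

  ∈-∖⁻ : ∀ a L {z} → z ∈ L ∖ a → z ∈ L × z ∉ a
  ∈-∖⁻ [] L m = m , λ ()
  ∈-∖⁻ (y ∷ a) L m with ∈-∖⁻ a (L ∖ₑ y) m
  ... | (m₁ , z∉a) with ∈-∖ₑ⁻ L y m₁
  ...   | (m₂ , z≢y) = m₂ , λ { (here e) → z≢y e ; (there q) → z∉a q }

  ∈-∖⁺ : ∀ a L {z} → z ∈ L → z ∉ a → z ∈ L ∖ a
  ∈-∖⁺ [] L m z∉a = m
  ∈-∖⁺ (y ∷ a) L m z∉a = ∈-∖⁺ a (L ∖ₑ y) (∈-∖ₑ⁺ L y m (λ e → z∉a (here e))) (λ q → z∉a (there q))

  ∖-unique : ∀ a L → Unique L → Unique (L ∖ a)
  ∖-unique [] L u = u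
  ∖-unique (y ∷ a) L u = ∖-unique a (L ∖ₑ y) (∖ₑ-unique L y u)

  arrangements : ℕ → List A → List (List A)
  arrangements zero L = [] ∷ []
  arrangements (suc j) L = map (uncurry _∷_) (pairs L (λ y → arrangements j (L ∖ₑ y)))

  private
    cons-injective : ∀ {p q : A × List A} → uncurry _∷_ p ≡ uncurry _∷_ q → p ≡ q
    cons-injective {_ , _} {_ , _} e = let (e₁ , e₂) = ∷-injective e in cong₂ _,_ e₁ e₂

    ∈-arrangements-suc⁻ : ∀ j L {a} → a ∈ arrangements (suc j) L →
      ∃[ y ] ∃[ a′ ] (a ≡ y ∷ a′ × y ∈ L × a′ ∈ arrangements j (L ∖ₑ y))
    ∈-arrangements-suc⁻ j L m with ∈-map⁻ (uncurry _∷_) m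
    ... | ((y , a′) , m′ , refl) =
      let (y∈ , a′∈) = ∈-pairs⁻ L (λ y → arrangements j (L ∖ₑ y)) m′ in y , a′ , refl , y∈ , a′∈

  ∈-arrangements⁻ : ∀ j L {a} → Unique L → a ∈ arrangements j L →
    length a ≡ j × Unique a × (∀ {z} → z ∈ a → z ∈ L)
  ∈-arrangements⁻ zero L u (here refl) = refl , [] , λ ()
  ∈-arrangements⁻ (suc j) L u m with ∈-arrangements-suc⁻ j L m
  ... | (y , a′ , refl , y∈ , a′∈) =
    let (len , ua′ , sub) = ∈-arrangements⁻ j (L ∖ₑ y) (∖ₑ-unique L y u) a′∈ in
    cong suc len ,
    All.tabulate (λ z∈ e → proj₂ (∈-∖ₑ⁻ L y (sub z∈)) (sym e)) ∷ ua′ ,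
    λ { (here refl) → y∈ ; (there q) → proj₁ (∈-∖ₑ⁻ L y (sub q)) }

  ∈-arrangements⁺ : ∀ j L {a} → length a ≡ j → Unique a → (∀ {z} → z ∈ a → z ∈ L) →
    a ∈ arrangements j L
  ∈-arrangements⁺ zero L {[]} len ua sub = here refl
  ∈-arrangements⁺ (suc j) L {y ∷ a} len (y∉ ∷ ua) sub =
    ∈-map⁺ (uncurry _∷_) (∈-pairs⁺ (sub (here refl))
      (∈-arrangements⁺ j (L ∖ₑ y) (suc-injective len) ua
        (λ z∈ → ∈-∖ₑ⁺ L y (sub (there z∈)) (λ e → All.lookup y∉ z∈ (sym e)))))

  arrangements-unique : ∀ j L → Unique L → Unique (arrangements j L)
  arrangements-unique zero L u = [] ∷ []
  arrangements-unique (suc j) L u =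
    map⁺ cons-injective (pairs-unique _ u (λ y → arrangements-unique j (L ∖ₑ y) (∖ₑ-unique L y u)))

  length-arrangements : ∀ j L → Unique L → length (arrangements j L) ≡ falling (length L) j
  length-arrangements zero L u = refl
  length-arrangements (suc j) L u =
    trans (length-map (uncurry _∷_) (pairs L _))
      (length-pairs L _ (falling (length L ∸ 1) j) λ y y∈ →
        trans (length-arrangements j (L ∖ₑ y) (∖ₑ-unique L y u))
              (cong (λ M → falling (M ∸ 1) j) (length-∖ₑ L y u y∈)))

  length-∖ : ∀ j L {a} → Unique L → a ∈ arrangements j L → length (L ∖ a) ≡ length L ∸ j
  length-∖ zero L u (here refl) = refl
  length-∖ (suc j) L u m with ∈-arrangements-suc⁻ j L m
  ... | (y , a′ , refl , y∈ , a′∈) =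
    trans (length-∖ j (L ∖ₑ y) (∖ₑ-unique L y u) a′∈) (cong (_∸ suc j) (length-∖ₑ L y u y∈))

oneHots : ℕ → List (List ℕ)
oneHots zero = []
oneHots (suc j) = (1 ∷ replicate j 0) ∷ map (0 ∷_) (oneHots j)

private
  sum-replicate-0 : ∀ j → sum (replicate j 0) ≡ 0
  sum-replicate-0 zero = refl
  sum-replicate-0 (suc j) = sum-replicate-0 j

  sum≡0⇒replicate : ∀ j ds → length ds ≡ j → sum ds ≡ 0 → ds ≡ replicate j 0
  sum≡0⇒replicate zero [] len s = refl
  sum≡0⇒replicate (suc j) (zero ∷ ds) len s = cong (0 ∷_) (sum≡0⇒replicate j ds (suc-injective len) s)

∈-oneHots⁻ : ∀ j {ds} → ds ∈ oneHots j → length ds ≡ j × sum ds ≡ 1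
∈-oneHots⁻ (suc j) (here refl) = cong suc (length-replicate j) , cong suc (sum-replicate-0 j)
∈-oneHots⁻ (suc j) (there m) with ∈-map⁻ (0 ∷_) m
... | (ds , m′ , refl) = let (len , s) = ∈-oneHots⁻ j m′ in cong suc len , s

∈-oneHots⁺ : ∀ j ds → length ds ≡ j → sum ds ≡ 1 → ds ∈ oneHots j
∈-oneHots⁺ zero [] len ()
∈-oneHots⁺ (suc j) (zero ∷ ds) len s = there (∈-map⁺ (0 ∷_) (∈-oneHots⁺ j ds (suc-injective len) s))
∈-oneHots⁺ (suc j) (suc zero ∷ ds) len s =
  here (cong (1 ∷_) (sum≡0⇒replicate j ds (suc-injective len) (suc-injective s)))
∈-oneHots⁺ (suc j) (suc (suc d) ∷ ds) len ()

oneHots-unique : ∀ j → Unique (oneHots j)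
oneHots-unique zero = []
oneHots-unique (suc j) =
  All.tabulate (λ m → head≢ (∈-map⁻ (0 ∷_) m)) ∷ map⁺ ∷-injectiveʳ (oneHots-unique j)
  where
  head≢ : ∀ {ds} → ∃[ ds′ ] (ds′ ∈ oneHots j × ds ≡ 0 ∷ ds′) → (1 ∷ replicate j 0) ≢ ds
  head≢ (_ , _ , refl) ()

length-oneHots : ∀ j → length (oneHots j) ≡ j
length-oneHots zero = refl
length-oneHots (suc j) = cong suc (trans (length-map (0 ∷_) (oneHots j)) (length-oneHots j))

-- The number of configurations counted below, for cycles of length k = k′+1:
-- count N M is the number of ways to split M objects into cycles of length k
-- each carrying a marked position (N ≥ M is fuel making the recursion
-- structural).  The first object's cycle is fixed by an arrangement of k′ of
-- the other M-1 objects and one of k positions.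
module Counting (k′ : ℕ) where

  k : ℕ
  k = suc k′

  count : ℕ → ℕ → ℕ
  count N zero = 1
  count zero (suc M) = 0
  count (suc N) (suc M) = falling M k′ * (k * count N (M ∸ k′))

  private
    regroup : ∀ (a b g s f : ℕ) → a * (b * g) * (s * f) ≡ (a * (g * f)) * (s * b)
    regroup = solve-∀

  count-! : ∀ q N → q * k ≤ N → count N (q * k) * q ! ≡ (q * k) !
  count-! zero N le = refl
  count-! (suc q) (suc N) (s≤s le) = begin
      falling (k′ + X) k′ * (k * count N (k′ + X ∸ k′)) * (suc q * q !)
        ≡⟨ cong (λ z → falling (k′ + X) k′ * (k * count N z) * (suc q * q !)) (m+n∸m≡n k′ X) ⟩
      falling (k′ + X) k′ * (k * count N X) * (suc q * q !)
        ≡⟨ regroup (falling (k′ + X) k′) k (count N X) (suc q) (q !) ⟩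
      falling (k′ + X) k′ * (count N X * q !) * (suc q * k)
        ≡⟨ cong (λ z → falling (k′ + X) k′ * z * (suc q * k)) (count-! q N (≤-trans (m≤n+m X k′) le)) ⟩
      falling (k′ + X) k′ * X ! * (suc q * k)
        ≡⟨ cong (λ z → falling z k′ * X ! * (suc q * k)) (+-comm k′ X) ⟩
      falling (X + k′) k′ * X ! * (suc q * k)
        ≡⟨ cong (_* (suc q * k)) (falling-! X k′) ⟩
      (X + k′) ! * (suc q * k)
        ≡⟨ cong (λ z → z ! * (suc q * k)) (+-comm X k′) ⟩
      (k′ + X) ! * suc (k′ + X)
        ≡⟨ *-comm ((k′ + X) !) (suc (k′ + X)) ⟩
      suc (k′ + X) ! ∎
    where
    open ≡-Reasoning
    X = q * k

  count≢0⇒∣ : ∀ N M → count N M ≢ 0 → k ∣ M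
  count≢0⇒∣ N zero nz = k ∣0
  count≢0⇒∣ zero (suc M) nz = ⊥-elim (nz refl)
  count≢0⇒∣ (suc N) (suc M) nz =
    subst (k ∣_) M∸k′+k≡1+M (∣m∣n⇒∣m+n (count≢0⇒∣ N (M ∸ k′) count≢0) ∣-refl)
    where
    falling≢0 : falling M k′ ≢ 0
    falling≢0 e = nz (cong (_* (k * count N (M ∸ k′))) e)
    count≢0 : count N (M ∸ k′) ≢ 0
    count≢0 e = nz (trans (cong (λ z → falling M k′ * (k * z)) e)
                    (trans (cong (falling M k′ *_) (*-zeroʳ k)) (*-zeroʳ (falling M k′))))
    M∸k′+k≡1+M : M ∸ k′ + k ≡ suc M
    M∸k′+k≡1+M = trans (+-suc (M ∸ k′) k′) (cong suc (m∸n+n≡m (falling≢0⇒≤ M k′ falling≢0)))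

vec-ext : ∀ {A : Set} {m} (u v : Vec A m) → (∀ i → lookup u i ≡ lookup v i) → u ≡ v
vec-ext u v h = trans (sym (tabulate∘lookup u)) (trans (tabulate-cong h) (tabulate∘lookup v))

-- Configurations of n objects (the paths of σ) for cycle length k = k′+1.
module Configurations (n k′ : ℕ) where

  open Counting k′ public using (k; count)
  open import Data.List.Membership.DecPropositional (_≟ᶠ_ {n}) using (_∈?_)
  open Arrangements (_≟ᶠ_ {n})

  Config : Set
  Config = Vec (Fin n × ℕ) n

  module _ (c : Config) where

    τ : Fin n → Fin n
    τ i = proj₁ (lookup c i)

    ε : Fin n → ℕ
    ε i = proj₂ (lookup c i)

    iter : ℕ → Fin n → Fin n
    iter zero y = y
    iter (suc t) y = iter t (τ y)

    drift : ℕ → Fin n → ℕ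
    drift zero y = 0
    drift (suc t) y = ε y + drift t (τ y)

    orbit : ℕ → Fin n → List (Fin n)
    orbit zero y = []
    orbit (suc t) y = y ∷ orbit t (τ y)

    -- y lies on a τ-cycle of length dividing k whose offsets sum to 1 per round.
    Returns : Fin n → Set
    Returns y = iter k y ≡ y × drift k y ≡ 1

    iter-+ : ∀ a b y → iter (a + b) y ≡ iter b (iter a y)
    iter-+ zero b y = refl
    iter-+ (suc a) b y = iter-+ a b (τ y)

    drift-+ : ∀ a b y → drift (a + b) y ≡ drift a y + drift b (iter a y)
    drift-+ zero b y = refl
    drift-+ (suc a) b y = trans (cong (ε y +_) (drift-+ a b (τ y))) (sym (+-assoc (ε y) _ _))

    iter-suc : ∀ t y → iter (suc t) y ≡ τ (iter t y)
    iter-suc zero y = refl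
    iter-suc (suc t) y = iter-suc t (τ y)

    iter-cycle : ∀ p y → iter p y ≡ y → ∀ j → iter (j * p) y ≡ y × drift (j * p) y ≡ j * drift p y
    iter-cycle p y e zero = refl , refl
    iter-cycle p y e (suc j) =
      let (back , drift≡) = iter-cycle p y e j in
      trans (iter-+ p (j * p) y) (trans (cong (iter (j * p)) e) back) ,
      trans (drift-+ p (j * p) y) (cong (drift p y +_) (trans (cong (drift (j * p)) e) drift≡))

    -- A returning point has exact period k: the drift 1 cannot be split into
    -- k/m equal parts for 0 < m < k.
    no-early-return : ∀ y → Returns y → ∀ m → 0 < m → m < k → iter m y ≢ y
    no-early-return y (back , drift≡1) m 0<m m<k back-m = impossible (drift m y) refl
      where
      m≡k*drift : m ≡ k * drift m y
      m≡k*drift = begin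
        m                    ≡⟨ sym (*-identityʳ m) ⟩
        m * 1                ≡⟨ cong (m *_) (sym drift≡1) ⟩
        m * drift k y        ≡⟨ sym (proj₂ (iter-cycle k y back m)) ⟩
        drift (m * k) y      ≡⟨ cong (λ z → drift z y) (*-comm m k) ⟩
        drift (k * m) y      ≡⟨ proj₂ (iter-cycle m y back-m k) ⟩
        k * drift m y        ∎
        where open ≡-Reasoning
      impossible : ∀ d → drift m y ≡ d → ⊥
      impossible zero e = <-irrefl (sym (trans m≡k*drift (trans (cong (k *_) e) (*-zeroʳ k)))) 0<m
      impossible (suc d) e =
        <-irrefl refl (<-≤-trans m<k (subst (k ≤_) (sym (trans m≡k*drift (cong (k *_) e))) (m≤m*n k (suc d))))

    Returns-τ : ∀ y → Returns y → Returns (τ y)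
    Returns-τ y (back , drift≡1) = trans (iter-suc k y) (cong τ back) , +-cancelˡ-≡ (ε y) _ _ shifted
      where
      shifted : ε y + drift k (τ y) ≡ ε y + 1
      shifted = begin
        drift (suc k) y                          ≡⟨ cong (λ z → drift z y) (+-comm 1 k) ⟩
        drift (k + 1) y                          ≡⟨ drift-+ k 1 y ⟩
        drift k y + (ε (iter k y) + 0)           ≡⟨ cong₂ (λ a b → a + (ε b + 0)) drift≡1 back ⟩
        1 + (ε y + 0)                            ≡⟨ cong suc (+-identityʳ (ε y)) ⟩
        suc (ε y)                                ≡⟨ +-comm 1 (ε y) ⟩
        ε y + 1                                  ∎
        where open ≡-Reasoning

    Returns-iter : ∀ s y → Returns y → Returns (iter s y)
    Returns-iter zero y r = r
    Returns-iter (suc s) y r = Returns-iter s (τ y) (Returns-τ y r)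

    length-orbit : ∀ t y → length (orbit t y) ≡ t
    length-orbit zero y = refl
    length-orbit (suc t) y = cong suc (length-orbit t (τ y))

    ∈-orbit⁻ : ∀ t y {z} → z ∈ orbit t y → ∃[ s ] (s < t × z ≡ iter s y)
    ∈-orbit⁻ (suc t) y (here e) = 0 , s≤s z≤n , e
    ∈-orbit⁻ (suc t) y (there m) = let (s , s<t , e) = ∈-orbit⁻ t (τ y) m in suc s , s≤s s<t , e

    ∈-orbit⁺ : ∀ t y s → s < t → iter s y ∈ orbit t y
    ∈-orbit⁺ (suc t) y zero lt = here refl
    ∈-orbit⁺ (suc t) y (suc s) (s≤s lt) = there (∈-orbit⁺ t (τ y) s lt)

    sum-ε-orbit : ∀ t y → sum (map ε (orbit t y)) ≡ drift t y
    sum-ε-orbit zero y = refl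
    sum-ε-orbit (suc t) y = cong (ε y +_) (sum-ε-orbit t (τ y))

    orbit-unique : ∀ t y → t ≤ k → Returns y → Unique (orbit t y)
    orbit-unique zero y le r = []
    orbit-unique (suc t) y le r =
      All.tabulate (λ z∈ e → let (s , s<t , z≡) = ∈-orbit⁻ t (τ y) z∈ in
        no-early-return y r (suc s) (s≤s z≤n) (<-≤-trans (s≤s s<t) le) (sym (trans e z≡)))
      ∷ orbit-unique t (τ y) (≤-trans (n≤1+n t) le) (Returns-τ y r)

    fixed-point : ∀ i → lookup c i ≡ (i , 0) → ∀ t → iter t i ≡ i × drift t i ≡ 0
    fixed-point i e zero = refl , refl
    fixed-point i e (suc t) =
      let (back , drift≡0) = fixed-point i e t
          (τi≡i , εi≡0) = (cong proj₁ e , cong proj₂ e) in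
      trans (cong (iter t) τi≡i) back , cong₂ _+_ εi≡0 (trans (cong (drift t) τi≡i) drift≡0)

    τ-injective : (∀ i → iter k i ≡ i) → ∀ i j → τ i ≡ τ j → i ≡ j
    τ-injective cyc i j e = trans (sym (cyc i)) (trans (cong (iter k′) e) (cyc j))

  FullOn : List (Fin n) → Config → Set
  FullOn L c = ∀ i → (i ∉ L → lookup c i ≡ (i , 0)) × (i ∈ L → Returns c i)

  FullOn⇒cyclic : ∀ L c → FullOn L c → ∀ i → iter c k i ≡ i
  FullOn⇒cyclic L c v i with i ∈? L
  ... | yes i∈ = proj₁ (proj₂ (v i) i∈)
  ... | no i∉ = proj₁ (fixed-point c i (proj₁ (v i) i∉) k)

  -- L is closed under τ (a point outside L is fixed, so cannot be τ i).
  FullOn-closed : ∀ L c → FullOn L c → ∀ {i} → i ∈ L → τ c i ∈ L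
  FullOn-closed L c v {i} i∈ with τ c i ∈? L
  ... | yes τi∈ = τi∈
  ... | no τi∉ = ⊥-elim (τi∉ (subst (_∈ L) i≡τi i∈))
    where
    i≡τi : i ≡ τ c i
    i≡τi = trans (sym (proj₁ (proj₂ (v i) i∈))) (proj₁ (fixed-point c (τ c i) (proj₁ (v (τ c i)) τi∉) k′))

  FullOn-closed-iter : ∀ L c → FullOn L c → ∀ s {i} → i ∈ L → iter c s i ∈ L
  FullOn-closed-iter L c v zero i∈ = i∈
  FullOn-closed-iter L c v (suc s) i∈ = FullOn-closed-iter L c v s (FullOn-closed L c v i∈)

  agree-on-invariant : ∀ (c c′ : Config) (P : Fin n → Set) → (∀ y → P y → lookup c y ≡ lookup c′ y) →
    (∀ y → P y → P (τ c′ y)) → ∀ t y → P y → iter c t y ≡ iter c′ t y × drift c t y ≡ drift c′ t y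
  agree-on-invariant c c′ P ag inv zero y py = refl , refl
  agree-on-invariant c c′ P ag inv (suc t) y py =
    let (iter≡ , drift≡) = agree-on-invariant c c′ P ag inv t (τ c′ y) (inv y py)
        τ≡ = cong proj₁ (ag y py) in
    trans (cong (iter c t) τ≡) iter≡ , cong₂ _+_ (cong proj₂ (ag y py)) (trans (cong (drift c t) τ≡) drift≡)

  Entry : Set
  Entry = Fin n × (Fin n × ℕ)

  patch : List Entry → Config → Config
  patch [] c = c
  patch ((z , v) ∷ ps) c = patch ps c [ z ]≔ v

  lookup-patch-∉ : ∀ ps c {y} → y ∉ map proj₁ ps → lookup (patch ps c) y ≡ lookup c y
  lookup-patch-∉ [] c y∉ = refl
  lookup-patch-∉ ((z , v) ∷ ps) c y∉ =
    trans (lookup∘update′ (λ e → y∉ (here e)) (patch ps c) v) (lookup-patch-∉ ps c (λ m → y∉ (there m)))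

  lookup-patch-∈ : ∀ ps c {y v} → Unique (map proj₁ ps) → (y , v) ∈ ps → lookup (patch ps c) y ≡ v
  lookup-patch-∈ ((z , w) ∷ ps) c u (here refl) = lookup∘update z (patch ps c) w
  lookup-patch-∈ ((z , w) ∷ ps) c (z∉ ∷ u) (there m) =
    trans (lookup∘update′ (λ e → All.lookup z∉ (∈-map⁺ proj₁ m) (sym e)) (patch ps c) w) (lookup-patch-∈ ps c u m)

  entries : (Fin n → Fin n × ℕ) → List (Fin n) → List Entry
  entries f zs = map (λ z → z , f z) zs

  keys-entries : ∀ f zs → map proj₁ (entries f zs) ≡ zs
  keys-entries f [] = refl
  keys-entries f (z ∷ zs) = cong (z ∷_) (keys-entries f zs)

  lookup-patch-entries-∈ : ∀ f zs c {y} → Unique zs → y ∈ zs → lookup (patch (entries f zs) c) y ≡ f y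
  lookup-patch-entries-∈ f zs c u y∈ =
    lookup-patch-∈ (entries f zs) c (subst Unique (sym (keys-entries f zs)) u) (∈-map⁺ (λ z → z , f z) y∈)

  lookup-patch-entries-∉ : ∀ f zs c {y} → y ∉ zs → lookup (patch (entries f zs) c) y ≡ lookup c y
  lookup-patch-entries-∉ f zs c y∉ = lookup-patch-∉ (entries f zs) c (subst (_ ∉_) (sym (keys-entries f zs)) y∉)

  linkEntries : Fin n → List (Fin n) → Fin n → List ℕ → List Entry
  linkEntries u [] w (d ∷ _) = (u , (w , d)) ∷ []
  linkEntries u (v ∷ vs) w (d ∷ ds) = (u , (v , d)) ∷ linkEntries v vs w ds
  linkEntries u _ w [] = []

  keys-linkEntries : ∀ u vs w ds → length ds ≡ suc (length vs) → map proj₁ (linkEntries u vs w ds) ≡ u ∷ vs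
  keys-linkEntries u [] w (d ∷ []) len = refl
  keys-linkEntries u (v ∷ vs) w (d ∷ ds) len = cong (u ∷_) (keys-linkEntries v vs w ds (suc-injective len))

  follow-link : ∀ (c : Config) u vs w ds → length ds ≡ suc (length vs) →
    (∀ {z v} → (z , v) ∈ linkEntries u vs w ds → lookup c z ≡ v) →
    orbit c (suc (length vs)) u ≡ u ∷ vs × iter c (suc (length vs)) u ≡ w × map (ε c) (u ∷ vs) ≡ ds
  follow-link c u [] w (d ∷ []) len h = refl , cong proj₁ (h (here refl)) , cong (_∷ []) (cong proj₂ (h (here refl)))
  follow-link c u (v ∷ vs) w (d ∷ ds) len h =
    let (orbit≡ , end≡ , offsets≡) = follow-link c v vs w ds (suc-injective len) (λ m → h (there m))
        step = h (here refl) in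
    cong (u ∷_) (trans (cong (orbit c (suc (length vs))) (cong proj₁ step)) orbit≡) ,
    trans (cong (iter c (suc (length vs))) (cong proj₁ step)) end≡ ,
    cong₂ _∷_ (cong proj₂ step) offsets≡

  linkEntries-orbit : ∀ (c : Config) t y →
    linkEntries y (orbit c t (τ c y)) (iter c (suc t) y) (map (ε c) (orbit c (suc t) y))
      ≡ entries (lookup c) (orbit c (suc t) y)
  linkEntries-orbit c zero y = refl
  linkEntries-orbit c (suc t) y = cong ((y , lookup c y) ∷_) (linkEntries-orbit c t (τ c y))

  identityConfig : Config
  identityConfig = tabulate (λ i → i , 0)

  -- A choice for the cycle through a new point x: the other k′ points of the
  -- cycle in order, the offsets along the cycle, and a configuration of the rest.
  Choice : Set
  Choice = List (Fin n) × List ℕ × Config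

  Admissible : List (Fin n) → Choice → Set
  Admissible L (a , ds , c′) = a ∈ arrangements k′ L × ds ∈ oneHots k × FullOn (L ∖ a) c′

  choices : (List (Fin n) → List Config) → List (Fin n) → List Choice
  choices rest L = pairs (arrangements k′ L) (λ a → pairs (oneHots k) (λ _ → rest (L ∖ a)))

  closeCycle : Fin n → Choice → Config
  closeCycle x (a , ds , c′) = patch (linkEntries x a x ds) c′

  openCycle : Fin n → Config → Choice
  openCycle x c = orbit c k′ (τ c x) , map (ε c) (orbit c k x) , patch (entries (λ z → z , 0) (orbit c k x)) c

  -- All configurations full on L, listing the cycle of the first point first;
  -- N ≥ length L is fuel.
  enumerate : ℕ → List (Fin n) → List Config
  enumerate N [] = identityConfig ∷ []
  enumerate zero (x ∷ L) = []
  enumerate (suc N) (x ∷ L) = map (closeCycle x) (choices (enumerate N) L)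

  ∈-choices⁻ : ∀ rest L {a ds c′} → (a , ds , c′) ∈ choices rest L →
    a ∈ arrangements k′ L × ds ∈ oneHots k × c′ ∈ rest (L ∖ a)
  ∈-choices⁻ rest L m =
    let (a∈ , m′) = ∈-pairs⁻ (arrangements k′ L) _ m
        (ds∈ , c′∈) = ∈-pairs⁻ (oneHots k) _ m′ in
    a∈ , ds∈ , c′∈

  ∈-choices⁺ : ∀ rest L {a ds c′} → a ∈ arrangements k′ L → ds ∈ oneHots k → c′ ∈ rest (L ∖ a) →
    (a , ds , c′) ∈ choices rest L
  ∈-choices⁺ rest L a∈ ds∈ c′∈ = ∈-pairs⁺ a∈ (∈-pairs⁺ ds∈ c′∈)

  unique-head : ∀ {x : Fin n} {L} → Unique (x ∷ L) → x ∉ L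
  unique-head (x∉ ∷ _) m = All.lookup x∉ m refl

  module ClosedCycle {L : List (Fin n)} {x : Fin n} {a : List (Fin n)} {ds : List ℕ} {c′ : Config}
    (uL : Unique L) (x∉L : x ∉ L) (adm : Admissible L (a , ds , c′)) where

    c : Config
    c = closeCycle x (a , ds , c′)

    private
      a∈ = proj₁ adm
      ds∈ = proj₁ (proj₂ adm)
      c′-full = proj₂ (proj₂ adm)
      len-a = proj₁ (∈-arrangements⁻ k′ L uL a∈)
      a⊆L = proj₂ (proj₂ (∈-arrangements⁻ k′ L uL a∈))

    cycle-unique : Unique (x ∷ a)
    cycle-unique = All.tabulate (λ z∈ e → x∉L (subst (_∈ L) (sym e) (a⊆L z∈))) ∷ proj₁ (proj₂ (∈-arrangements⁻ k′ L uL a∈))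

    private
      len-ds : length ds ≡ suc (length a)
      len-ds = trans (proj₁ (∈-oneHots⁻ k ds∈)) (cong suc (sym len-a))
      keys : map proj₁ (linkEntries x a x ds) ≡ x ∷ a
      keys = keys-linkEntries x a x ds len-ds
      walk = follow-link c x a x ds len-ds (lookup-patch-∈ _ c′ (subst Unique (sym keys) cycle-unique))

    orbit-x : orbit c k x ≡ x ∷ a
    orbit-x = subst (λ t → orbit c (suc t) x ≡ x ∷ a) len-a (proj₁ walk)

    offsets : map (ε c) (x ∷ a) ≡ ds
    offsets = proj₂ (proj₂ walk)

    x-returns : Returns c x
    x-returns = subst (λ t → iter c (suc t) x ≡ x) len-a (proj₁ (proj₂ walk)) , drift≡1
      where
      open ≡-Reasoning
      drift≡1 : drift c k x ≡ 1
      drift≡1 = begin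
        drift c k x              ≡⟨ sym (sum-ε-orbit c k x) ⟩
        sum (map (ε c) (orbit c k x)) ≡⟨ cong (λ l → sum (map (ε c) l)) orbit-x ⟩
        sum (map (ε c) (x ∷ a))  ≡⟨ cong sum offsets ⟩
        sum ds                   ≡⟨ proj₂ (∈-oneHots⁻ k ds∈) ⟩
        1                        ∎

    outside : ∀ {y} → y ∉ x ∷ a → lookup c y ≡ lookup c′ y
    outside y∉ = lookup-patch-∉ (linkEntries x a x ds) c′ (subst (_ ∉_) (sym keys) y∉)

    rest-off-cycle : ∀ {z} → z ∈ L ∖ a → z ∉ x ∷ a
    rest-off-cycle z∈ (here e) = x∉L (subst (_∈ L) e (proj₁ (∈-∖⁻ a L z∈)))
    rest-off-cycle z∈ (there q) = proj₂ (∈-∖⁻ a L z∈) q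

    off-cycle-invariant : ∀ y → y ∉ x ∷ a → τ c′ y ∉ x ∷ a
    off-cycle-invariant y y∉ with y ∈? (L ∖ a)
    ... | yes y∈ = rest-off-cycle (FullOn-closed (L ∖ a) c′ c′-full y∈)
    ... | no y∉rest = subst (_∉ x ∷ a) (sym (cong proj₁ (proj₁ (c′-full y) y∉rest))) y∉

    closeCycle-FullOn : FullOn (x ∷ L) c
    closeCycle-FullOn i = fixed , returns
      where
      fixed : i ∉ x ∷ L → lookup c i ≡ (i , 0)
      fixed i∉ = trans (outside (λ { (here e) → i∉ (here e) ; (there m) → i∉ (there (a⊆L m)) }))
                       (proj₁ (c′-full i) (λ m → i∉ (there (proj₁ (∈-∖⁻ a L m)))))
      returns : i ∈ x ∷ L → Returns c i
      returns i∈ with i ∈? (x ∷ a)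
      ... | yes on = let (s , _ , e) = ∈-orbit⁻ c k x (subst (i ∈_) (sym orbit-x) on) in
                     subst (Returns c) (sym e) (Returns-iter c s x x-returns)
      ... | no off = trans (proj₁ same) (proj₁ old) , trans (proj₂ same) (proj₂ old)
        where
        in-rest : i ∈ x ∷ L → i ∈ L ∖ a
        in-rest (here e) = ⊥-elim (off (here e))
        in-rest (there iL) = ∈-∖⁺ a L iL (λ ia → off (there ia))
        old = proj₂ (c′-full i) (in-rest i∈)
        same = agree-on-invariant c c′ (_∉ x ∷ a) (λ _ → outside) off-cycle-invariant k i off

    openCycle∘closeCycle : openCycle x c ≡ (a , ds , c′)
    openCycle∘closeCycle =
      cong₂ _,_ (∷-injectiveʳ orbit-x) (cong₂ _,_ (trans (cong (map (ε c)) orbit-x) offsets) reset≡c′)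
      where
      reset-cycle : ∀ y → lookup (patch (entries (λ z → z , 0) (x ∷ a)) c) y ≡ lookup c′ y
      reset-cycle y with y ∈? (x ∷ a)
      ... | yes on = trans (lookup-patch-entries-∈ _ (x ∷ a) c cycle-unique on)
                           (sym (proj₁ (c′-full y) (λ y∈ → rest-off-cycle y∈ on)))
      ... | no off = trans (lookup-patch-entries-∉ _ (x ∷ a) c off) (outside off)
      reset≡c′ : patch (entries (λ z → z , 0) (orbit c k x)) c ≡ c′
      reset≡c′ = trans (cong (λ l → patch (entries (λ z → z , 0) l) c) orbit-x) (vec-ext _ _ reset-cycle)

  module OpenedCycle {L : List (Fin n)} {x : Fin n} {c : Config}
    (uL : Unique L) (x∉L : x ∉ L) (full : FullOn (x ∷ L) c) where

    private
      x-returns : Returns c x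
      x-returns = proj₂ (full x) (here refl)

    zs : List (Fin n)
    zs = orbit c k x

    a : List (Fin n)
    a = orbit c k′ (τ c x)

    ds : List ℕ
    ds = map (ε c) zs

    c″ : Config
    c″ = patch (entries (λ z → z , 0) zs) c

    zs-unique : Unique zs
    zs-unique = orbit-unique c k x ≤-refl x-returns

    a⊆L : ∀ {z} → z ∈ a → z ∈ L
    a⊆L {z} z∈ with on-cycle (there z∈)
      where
      on-cycle : z ∈ zs → z ∈ x ∷ L
      on-cycle m = let (s , _ , e) = ∈-orbit⁻ c k x m in
                   subst (_∈ x ∷ L) (sym e) (FullOn-closed-iter (x ∷ L) c full s (here refl))
    ... | here e with zs-unique
    ...   | x∉a ∷ _ = ⊥-elim (All.lookup x∉a z∈ (sym e))
    a⊆L z∈ | there z∈L = z∈L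

    c″-on-cycle : ∀ {y} → y ∈ zs → lookup c″ y ≡ (y , 0)
    c″-on-cycle = lookup-patch-entries-∈ _ zs c zs-unique

    c″-off-cycle : ∀ {y} → y ∉ zs → lookup c″ y ≡ lookup c y
    c″-off-cycle = lookup-patch-entries-∉ _ zs c

    -- Since τ is injective, a point off the cycle is not mapped onto it.
    off-cycle-invariant : ∀ y → y ∉ zs → τ c y ∉ zs
    off-cycle-invariant y y∉ τy∈ with ∈-orbit⁻ c k x τy∈
    ... | (zero , _ , e) =
      y∉ (subst (_∈ zs) (sym (τ-inj y (iter c k′ x) (trans e (trans (sym (proj₁ x-returns)) (iter-suc c k′ x)))))
                (∈-orbit⁺ c k x k′ ≤-refl))
      where τ-inj = τ-injective c (FullOn⇒cyclic (x ∷ L) c full)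
    ... | (suc s , s≤s s<k′ , e) =
      y∉ (subst (_∈ zs) (sym (τ-inj y (iter c s x) (trans e (iter-suc c s x))))
                (∈-orbit⁺ c k x s (≤-trans (n≤1+n _) (s≤s s<k′))))
      where τ-inj = τ-injective c (FullOn⇒cyclic (x ∷ L) c full)

    c″-full : FullOn (L ∖ a) c″
    c″-full i = fixed , returns
      where
      fixed : i ∉ L ∖ a → lookup c″ i ≡ (i , 0)
      fixed i∉ with i ∈? zs
      ... | yes on = c″-on-cycle on
      ... | no off = trans (c″-off-cycle off)
              (proj₁ (full i) λ { (here e) → off (here e)
                                ; (there iL) → i∉ (∈-∖⁺ a L iL (λ ia → off (there ia))) })
      returns : i ∈ L ∖ a → Returns c″ i
      returns i∈ = trans (proj₁ same) (proj₁ old) , trans (proj₂ same) (proj₂ old)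
        where
        iL = proj₁ (∈-∖⁻ a L i∈)
        off : i ∉ zs
        off (here e) = x∉L (subst (_∈ L) e iL)
        off (there q) = proj₂ (∈-∖⁻ a L i∈) q
        old = proj₂ (full i) (there iL)
        same = agree-on-invariant c″ c (_∉ zs) (λ _ → c″-off-cycle) off-cycle-invariant k i off

    openCycle-Admissible : Admissible L (openCycle x c)
    openCycle-Admissible =
      ∈-arrangements⁺ k′ L (length-orbit c k′ (τ c x)) (tail-unique zs-unique) a⊆L ,
      ∈-oneHots⁺ k ds (trans (length-map (ε c) zs) (length-orbit c k x)) (trans (sum-ε-orbit c k x) (proj₂ x-returns)) ,
      c″-full
      where
      tail-unique : ∀ {y ys} → Unique (y ∷ ys) → Unique ys
      tail-unique (_ ∷ u) = u

    closeCycle∘openCycle : closeCycle x (openCycle x c) ≡ c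
    closeCycle∘openCycle = begin
      patch (linkEntries x a x ds) c″            ≡⟨ cong (λ w → patch (linkEntries x a w ds) c″) (sym (proj₁ x-returns)) ⟩
      patch (linkEntries x a (iter c k x) ds) c″ ≡⟨ cong (λ ps → patch ps c″) (linkEntries-orbit c k′ x) ⟩
      patch (entries (lookup c) zs) c″           ≡⟨ vec-ext _ _ restore ⟩
      c                                          ∎
      where
      open ≡-Reasoning
      restore : ∀ y → lookup (patch (entries (lookup c) zs) c″) y ≡ lookup c y
      restore y with y ∈? zs
      ... | yes on = lookup-patch-entries-∈ (lookup c) zs c″ zs-unique on
      ... | no off = trans (lookup-patch-entries-∉ (lookup c) zs c″ off) (c″-off-cycle off)

  enumerate-sound : ∀ N L {c} → Unique L → c ∈ enumerate N L → FullOn L c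
  enumerate-sound N [] u (here refl) i = (λ _ → lookup∘tabulate _ i) , (λ ())
  enumerate-sound (suc N) (x ∷ L) (x∉ ∷ u) c∈ with ∈-map⁻ (closeCycle x) c∈
  ... | ((a , ds , c′) , t∈ , refl) =
    let (a∈ , ds∈ , c′∈) = ∈-choices⁻ (enumerate N) L t∈ in
    ClosedCycle.closeCycle-FullOn u (unique-head (x∉ ∷ u))
      (a∈ , ds∈ , enumerate-sound N (L ∖ a) (∖-unique a L u) c′∈)

  enumerate-complete : ∀ N L {c} → Unique L → length L ≤ N → FullOn L c → c ∈ enumerate N L
  enumerate-complete N [] u le full =
    here (vec-ext _ _ (λ i → trans (proj₁ (full i) (λ ())) (sym (lookup∘tabulate _ i))))
  enumerate-complete (suc N) (x ∷ L) {c} (x∉ ∷ u) (s≤s le) full =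
    subst (_∈ enumerate (suc N) (x ∷ L)) closeCycle∘openCycle
      (∈-map⁺ (closeCycle x) (∈-choices⁺ (enumerate N) L a∈ ds∈
        (enumerate-complete N (L ∖ a) (∖-unique a L u) rest≤N c″-full)))
    where
    open OpenedCycle u (unique-head (x∉ ∷ u)) full
    a∈ = proj₁ openCycle-Admissible
    ds∈ = proj₁ (proj₂ openCycle-Admissible)
    rest≤N : length (L ∖ a) ≤ N
    rest≤N = ≤-trans (≤-reflexive (length-∖ k′ L u a∈)) (≤-trans (m∸n≤m (length L) k′) le)

  enumerate-unique : ∀ N L → Unique L → Unique (enumerate N L)
  enumerate-unique N [] u = [] ∷ []
  enumerate-unique zero (x ∷ L) u = []
  enumerate-unique (suc N) (x ∷ L) (x∉ ∷ u) =
    map-unique (closeCycle x) (choices (enumerate N) L) choices-unique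
      (λ t t′ t∈ t′∈ e → trans (sym (open-close t t∈)) (trans (cong (openCycle x) e) (open-close t′ t′∈)))
    where
    choices-unique : Unique (choices (enumerate N) L)
    choices-unique = pairs-unique _ (arrangements-unique k′ L u) λ a →
      pairs-unique _ (oneHots-unique k) (λ _ → enumerate-unique N (L ∖ a) (∖-unique a L u))
    open-close : ∀ t → t ∈ choices (enumerate N) L → openCycle x (closeCycle x t) ≡ t
    open-close (a , ds , c′) t∈ =
      let (a∈ , ds∈ , c′∈) = ∈-choices⁻ (enumerate N) L t∈ in
      ClosedCycle.openCycle∘closeCycle u (unique-head (x∉ ∷ u))
        (a∈ , ds∈ , enumerate-sound N (L ∖ a) (∖-unique a L u) c′∈)

  length-enumerate : ∀ N L → Unique L → length (enumerate N L) ≡ count N (length L)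
  length-enumerate N [] u = refl
  length-enumerate zero (x ∷ L) u = refl
  length-enumerate (suc N) (x ∷ L) (_ ∷ u) = begin
    length (map (closeCycle x) (choices (enumerate N) L))
      ≡⟨ length-map (closeCycle x) (choices (enumerate N) L) ⟩
    length (choices (enumerate N) L)
      ≡⟨ length-pairs (arrangements k′ L) _ (k * count N (length L ∸ k′)) per-arrangement ⟩
    length (arrangements k′ L) * (k * count N (length L ∸ k′))
      ≡⟨ cong (_* (k * count N (length L ∸ k′))) (length-arrangements k′ L u) ⟩
    falling (length L) k′ * (k * count N (length L ∸ k′)) ∎
    where
    open ≡-Reasoning
    per-arrangement : ∀ a → a ∈ arrangements k′ L →
      length (pairs (oneHots k) (λ _ → enumerate N (L ∖ a))) ≡ k * count N (length L ∸ k′)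
    per-arrangement a a∈ =
      trans (length-pairs (oneHots k) (λ _ → enumerate N (L ∖ a)) (count N (length L ∸ k′)) (λ _ _ →
               trans (length-enumerate N (L ∖ a) (∖-unique a L u)) (cong (count N) (length-∖ k′ L u a∈))))
            (cong (_* count N (length L ∸ k′)) (length-oneHots k))

  Full : Config → Set
  Full c = ∀ i → Returns c i

  fullConfigs : List Config
  fullConfigs = enumerate n (allFin n)

  ∈-fullConfigs⁻ : ∀ {c} → c ∈ fullConfigs → Full c
  ∈-fullConfigs⁻ c∈ i = proj₂ (enumerate-sound n (allFin n) (allFin⁺ n) c∈ i) (∈-allFin i)

  ∈-fullConfigs⁺ : ∀ {c} → Full c → c ∈ fullConfigs
  ∈-fullConfigs⁺ full = enumerate-complete n (allFin n) (allFin⁺ n) (≤-reflexive (length-tabulate {n = n} (λ i → i)))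
    (λ i → (λ i∉ → ⊥-elim (i∉ (∈-allFin i))) , (λ _ → full i))

  fullConfigs-unique : Unique fullConfigs
  fullConfigs-unique = enumerate-unique n (allFin n) (allFin⁺ n)

  length-fullConfigs : length fullConfigs ≡ count n n
  length-fullConfigs = trans (length-enumerate n (allFin n) (allFin⁺ n)) (cong (count n) (length-tabulate {n = n} (λ i → i)))

bind-just⁻ : ∀ {A B : Set} (ma : Maybe A) (f : A → Maybe B) {b} → (ma >>= f) ≡ just b →
  ∃[ a ] (ma ≡ just a × f a ≡ just b)
bind-just⁻ (just a) f e = a , refl , e

map-just⁻ : ∀ {A B : Set} (f : A → B) (ma : Maybe A) {b} → Maybe.map f ma ≡ just b →
  ∃[ a ] (ma ≡ just a × f a ≡ b)
map-just⁻ f (just a) refl = a , refl , refl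

>>=-just : ∀ {A : Set} (ma : Maybe A) → (ma >>= just) ≡ ma
>>=-just (just a) = refl
>>=-just nothing = refl

module Positions {r : ℕ} where

  advance : ℕ → Fin r → Maybe (Fin r)
  advance zero j = just j
  advance (suc d) j = nextPos j >>= advance d

  advance-+ : ∀ a b j → advance (a + b) j ≡ (advance a j >>= advance b)
  advance-+ zero b j = refl
  advance-+ (suc a) b j with nextPos j
  ... | just u = advance-+ a b u
  ... | nothing = refl

  advance-suc : ∀ t j → advance (suc t) j ≡ (advance t j >>= nextPos)
  advance-suc t j = begin
    advance (suc t) j                ≡⟨ cong (λ z → advance z j) (+-comm 1 t) ⟩
    advance (t + 1) j                ≡⟨ advance-+ t 1 j ⟩
    (advance t j >>= advance 1)      ≡⟨ step (advance t j) ⟩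
    (advance t j >>= nextPos)        ∎
    where
    open ≡-Reasoning
    step : ∀ ma → (ma >>= advance 1) ≡ (ma >>= nextPos)
    step (just u) = >>=-just (nextPos u)
    step nothing = refl

  private
    nextPos-toℕ : ∀ {s} (j u : Fin s) → nextPos j ≡ just u → toℕ u ≡ suc (toℕ j)
    nextPos-toℕ {suc (suc s)} fzero u refl = refl
    nextPos-toℕ {suc (suc s)} (fsuc j) u e with map-just⁻ fsuc (nextPos j) e
    ... | (v , e′ , refl) = cong suc (nextPos-toℕ j v e′)

    nextPos-exists : ∀ {s} (j : Fin s) → suc (toℕ j) < s → ∃[ u ] (nextPos j ≡ just u)
    nextPos-exists {suc zero} fzero (s≤s ())
    nextPos-exists {suc (suc s)} fzero lt = fsuc fzero , refl
    nextPos-exists {suc (suc s)} (fsuc j) (s≤s lt) with nextPos-exists j lt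
    ... | (u , e) = fsuc u , cong (Maybe.map fsuc) e

  advance-toℕ : ∀ d j {u} → advance d j ≡ just u → toℕ u ≡ d + toℕ j
  advance-toℕ zero j refl = refl
  advance-toℕ (suc d) j e with bind-just⁻ (nextPos j) (advance d) e
  ... | (v , e₁ , e₂) = trans (advance-toℕ d v e₂) (trans (cong (d +_) (nextPos-toℕ j v e₁)) (+-suc d (toℕ j)))

  advance-exists : ∀ d j → d + toℕ j < r → ∃[ u ] (advance d j ≡ just u)
  advance-exists zero j lt = j , refl
  advance-exists (suc d) j lt with nextPos-exists j (≤-trans (s≤s (s≤s (m≤n+m (toℕ j) d))) lt)
  ... | (v , e) with advance-exists d v (subst (_< r) (sym (trans (cong (d +_) (nextPos-toℕ j v e)) (+-suc d (toℕ j)))) lt)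
  ...   | (u , e′) = u , trans (cong (_>>= advance d) e) e′

  advance-injective : ∀ d j j′ {u} → advance d j ≡ just u → advance d j′ ≡ just u → j ≡ j′
  advance-injective d j j′ e e′ = toℕ-injective (+-cancelˡ-≡ d _ _ (trans (sym (advance-toℕ d j e)) (advance-toℕ d j′ e′)))

module _ {r : ℕ} where
  open Positions {suc r}

  advance-from-start : ∀ j → advance (toℕ j) fzero ≡ just j
  advance-from-start j with advance-exists (toℕ j) fzero (subst (_< suc r) (sym (+-identityʳ (toℕ j))) (toℕ<n j))
  ... | (u , e) = trans e (cong just (toℕ-injective (trans (advance-toℕ (toℕ j) fzero e) (+-identityʳ (toℕ j)))))

  advance-swap : ∀ j j′ → advance (toℕ j) j′ ≡ advance (toℕ j′) j
  advance-swap j j′ = begin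
    advance (toℕ j) j′                              ≡⟨ cong (_>>= advance (toℕ j)) (sym (advance-from-start j′)) ⟩
    (advance (toℕ j′) fzero >>= advance (toℕ j))    ≡⟨ sym (advance-+ (toℕ j′) (toℕ j) fzero) ⟩
    advance (toℕ j′ + toℕ j) fzero                  ≡⟨ cong (λ z → advance z fzero) (+-comm (toℕ j′) (toℕ j)) ⟩
    advance (toℕ j + toℕ j′) fzero                  ≡⟨ advance-+ (toℕ j) (toℕ j′) fzero ⟩
    (advance (toℕ j) fzero >>= advance (toℕ j′))    ≡⟨ cong (_>>= advance (toℕ j′)) (advance-from-start j) ⟩
    advance (toℕ j′) j                              ∎
    where open ≡-Reasoning

module Powers {m : ℕ} where

  app-id : ∀ x → app (idₚ {m}) x ≡ just x
  app-id x = lookup∘tabulate just x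

  app-∘ : ∀ (α β : PMap m) x → app (α ∘ₚ β) x ≡ (app β x >>= app α)
  app-∘ α β x = lookup∘tabulate (λ x → app β x >>= app α) x

  -- α^(t+1) x = α^t (α x): powers may be unfolded on the inside.
  app-^-suc : ∀ (α : PMap m) t x → app (α ^ₚ suc t) x ≡ (app α x >>= app (α ^ₚ t))
  app-^-suc α zero x = trans (app-∘ α idₚ x) (trans (cong (_>>= app α) (app-id x)) (sym (bind-id (app α x))))
    where
    bind-id : ∀ ma → (ma >>= app (idₚ {m})) ≡ ma
    bind-id (just y) = app-id y
    bind-id nothing = refl
  app-^-suc α (suc t) x =
    trans (app-∘ α (α ^ₚ suc t) x) (trans (cong (_>>= app α) (app-^-suc α t x)) (reassoc (app α x)))
    where
    reassoc : ∀ ma → ((ma >>= app (α ^ₚ t)) >>= app α) ≡ (ma >>= app (α ^ₚ suc t))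
    reassoc (just y) = sym (app-∘ α (α ^ₚ t) y)
    reassoc nothing = refl

  ^-commutes : ∀ (α : PMap m) t x → (app α x >>= app (α ^ₚ t)) ≡ (app (α ^ₚ t) x >>= app α)
  ^-commutes α t x = trans (sym (app-^-suc α t x)) (app-∘ α (α ^ₚ t) x)

-- The k-th roots of a product σ of n disjoint paths p i 0 → ⋯ → p i (ℓ-1)
-- of length ℓ ≥ 2 (ℓ = ℓ′+2, k = k′+1) are the maps of full configurations.
module Roots {m n ℓ′ k′ : ℕ} (σ : PMap m) (p : Fin n → Fin (suc (suc ℓ′)) → Fin m)
  (σ-paths : IsProductOfPaths n (suc (suc ℓ′)) σ p) where

  open Configurations n k′
  open Positions {suc (suc ℓ′)}
  open Powers {m}

  private
    p-injective : ∀ i j i′ j′ → p i j ≡ p i′ j′ → i ≡ i′ × j ≡ j′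
    p-injective = proj₁ σ-paths

    σ-on-paths : ∀ i j → app σ (p i j) ≡ Maybe.map (p i) (nextPos j)
    σ-on-paths = proj₂ (proj₂ σ-paths)

  coords : Fin m → Fin n × Fin (suc (suc ℓ′))
  coords y = let (i , j , _) = proj₁ (proj₂ σ-paths) y in i , j

  coords-sound : ∀ y → p (proj₁ (coords y)) (proj₂ (coords y)) ≡ y
  coords-sound y = proj₂ (proj₂ (proj₁ (proj₂ σ-paths) y))

  coords-p : ∀ i j → coords (p i j) ≡ (i , j)
  coords-p i j = let (i≡ , j≡) = p-injective _ _ i j (coords-sound (p i j)) in cong₂ _,_ i≡ j≡

  on-digits : (P : Fin m → Set) → (∀ i j → P (p i j)) → ∀ x → P x
  on-digits P h x = subst P (coords-sound x) (h _ _)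

  pmap-ext : ∀ (α β : PMap m) → (∀ i j → app α (p i j) ≡ app β (p i j)) → α ≡ β
  pmap-ext α β h = vec-ext α β (on-digits (λ x → lookup α x ≡ lookup β x) h)

  rootOf : Config → PMap m
  rootOf c = tabulate (λ y → let (i , j) = coords y in Maybe.map (p (τ c i)) (advance (ε c i) j))

  app-rootOf : ∀ c i j → app (rootOf c) (p i j) ≡ Maybe.map (p (τ c i)) (advance (ε c i) j)
  app-rootOf c i j = trans (lookup∘tabulate _ (p i j))
    (cong (λ (ij : Fin n × Fin (suc (suc ℓ′))) → Maybe.map (p (τ c (proj₁ ij))) (advance (ε c (proj₁ ij)) (proj₂ ij)))
          (coords-p i j))

  app-rootOf-^ : ∀ c t i j → app (rootOf c ^ₚ t) (p i j) ≡ Maybe.map (p (iter c t i)) (advance (drift c t i) j)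
  app-rootOf-^ c zero i j = app-id (p i j)
  app-rootOf-^ c (suc t) i j = begin
    app (rootOf c ^ₚ suc t) (p i j)
      ≡⟨ app-^-suc (rootOf c) t (p i j) ⟩
    (app (rootOf c) (p i j) >>= app (rootOf c ^ₚ t))
      ≡⟨ cong (_>>= app (rootOf c ^ₚ t)) (app-rootOf c i j) ⟩
    (Maybe.map (p (τ c i)) (advance (ε c i) j) >>= app (rootOf c ^ₚ t))
      ≡⟨ continue (advance (ε c i) j) ⟩
    Maybe.map (p (iter c t (τ c i))) (advance (ε c i) j >>= advance (drift c t (τ c i)))
      ≡⟨ cong (Maybe.map (p (iter c t (τ c i)))) (sym (advance-+ (ε c i) (drift c t (τ c i)) j)) ⟩
    Maybe.map (p (iter c t (τ c i))) (advance (drift c (suc t) i) j) ∎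
    where
    open ≡-Reasoning
    continue : ∀ mj → (Maybe.map (p (τ c i)) mj >>= app (rootOf c ^ₚ t))
                      ≡ Maybe.map (p (iter c t (τ c i))) (mj >>= advance (drift c t (τ c i)))
    continue (just u) = app-rootOf-^ c t (τ c i) u
    continue nothing = refl

  rootOf-IsSIM : ∀ c → (∀ i → iter c k i ≡ i) → IsSIM (rootOf c)
  rootOf-IsSIM c cyc = on-digits _ λ i j → on-digits _ λ i′ j′ z e e′ → same-digit i j i′ j′ z e e′
    where
    same-digit : ∀ i j i′ j′ z → app (rootOf c) (p i j) ≡ just z → app (rootOf c) (p i′ j′) ≡ just z → p i j ≡ p i′ j′
    same-digit i j i′ j′ z e e′
      with map-just⁻ (p (τ c i)) (advance (ε c i) j) (trans (sym (app-rootOf c i j)) e)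
         | map-just⁻ (p (τ c i′)) (advance (ε c i′) j′) (trans (sym (app-rootOf c i′ j′)) e′)
    ... | (u , eu , pu) | (u′ , eu′ , pu′) with p-injective _ _ _ _ (trans pu (sym pu′))
    ...   | (τi≡τi′ , refl) with τ-injective c cyc i i′ τi≡τi′
    ...     | refl = cong (p i) (advance-injective (ε c i) j j′ eu eu′)

  rootOf-^k : ∀ c → Full c → rootOf c ^ₚ k ≡ σ
  rootOf-^k c full = pmap-ext _ _ λ i j → begin
    app (rootOf c ^ₚ k) (p i j)                            ≡⟨ app-rootOf-^ c k i j ⟩
    Maybe.map (p (iter c k i)) (advance (drift c k i) j)   ≡⟨ cong₂ (λ a b → Maybe.map (p a) (advance b j)) (proj₁ (full i)) (proj₂ (full i)) ⟩
    Maybe.map (p i) (nextPos j >>= just)                   ≡⟨ cong (Maybe.map (p i)) (>>=-just (nextPos j)) ⟩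
    Maybe.map (p i) (nextPos j)                            ≡⟨ sym (σ-on-paths i j) ⟩
    app σ (p i j)                                          ∎
    where open ≡-Reasoning

  rootOf-IsRoot : ∀ c → Full c → IsRoot k σ (rootOf c)
  rootOf-IsRoot c full = rootOf-IsSIM c (λ i → proj₁ (full i)) , rootOf-^k c full

  -- A full configuration is recovered from its map at the path starts p i 0.
  rootOf-injective : ∀ c c′ → Full c → Full c′ → rootOf c ≡ rootOf c′ → c ≡ c′
  rootOf-injective c c′ full full′ eq = vec-ext c c′ same-entry
    where
    -- An offset is at most the drift 1 < ℓ, so p i 0 is sent to position ε c i.
    start-image : ∀ c → Full c → ∀ i → ∃[ u ] (app (rootOf c) (p i fzero) ≡ just (p (τ c i) u) × toℕ u ≡ ε c i)
    start-image c full i =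
      let ε≤1 = subst (ε c i ≤_) (proj₂ (full i)) (m≤m+n (ε c i) (drift c k′ (τ c i)))
          (u , e) = advance-exists (ε c i) fzero (s≤s (≤-trans (≤-reflexive (+-identityʳ (ε c i))) (≤-trans ε≤1 (s≤s z≤n)))) in
      u , trans (app-rootOf c i fzero) (cong (Maybe.map (p (τ c i))) e) ,
      trans (advance-toℕ (ε c i) fzero e) (+-identityʳ (ε c i))
    same-entry : ∀ i → lookup c i ≡ lookup c′ i
    same-entry i with start-image c full i | start-image c′ full′ i
    ... | (u , e , u≡) | (u′ , e′ , u′≡)
      with p-injective _ _ _ _ (just-injective (trans (sym e) (trans (cong (λ β → app β (p i fzero)) eq) e′)))
    ...   | (τ≡ , refl) = cong₂ _,_ τ≡ (trans (sym u≡) u′≡)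

  module FromRoot (α : PMap m) (root : IsRoot k σ α) where

    private
      α^k≡σ : α ^ₚ k ≡ σ
      α^k≡σ = proj₂ root

    decode : Fin n → Maybe (Fin m) → Fin n × ℕ
    decode i (just y) = proj₁ (coords y) , toℕ (proj₂ (coords y))
    decode i nothing = i , 0

    configOf : Config
    configOf = tabulate (λ i → decode i (app α (p i fzero)))

    commutes : ∀ x → (app α x >>= app σ) ≡ (app σ x >>= app α)
    commutes x = subst (λ β → (app α x >>= app β) ≡ (app β x >>= app α)) α^k≡σ (^-commutes α k x)

    -- α is defined at each path start, since σ = α^k is (here ℓ ≥ 2 is used).
    start-defined : ∀ i → ∃[ y ] (app α (p i fzero) ≡ just y)
    start-defined i with app α (p i fzero) in e
    ... | just y = y , refl
    ... | nothing
      with trans (sym (trans (app-^-suc α k′ (p i fzero)) (cong (_>>= app (α ^ₚ k′)) e)))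
                 (trans (cong (λ β → app β (p i fzero)) α^k≡σ) (σ-on-paths i fzero))
    ...   | ()

    private
      σ-after : ∀ i′ mj → (Maybe.map (p i′) mj >>= app σ) ≡ Maybe.map (p i′) (mj >>= nextPos)
      σ-after i′ (just u) = σ-on-paths i′ u
      σ-after i′ nothing = refl

    along-path : ∀ i {y₀} → app α (p i fzero) ≡ just y₀ → ∀ j →
      app α (p i j) ≡ Maybe.map (p (proj₁ (coords y₀))) (advance (toℕ (proj₂ (coords y₀))) j)
    along-path i {y₀} e j =
      trans (by-steps (toℕ j) j (advance-from-start j)) (cong (Maybe.map (p i′)) (advance-swap j j′))
      where
      i′ = proj₁ (coords y₀)
      j′ = proj₂ (coords y₀)
      by-steps : ∀ t j → advance t fzero ≡ just j → app α (p i j) ≡ Maybe.map (p i′) (advance t j′)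
      by-steps zero j refl = trans e (cong just (sym (coords-sound y₀)))
      by-steps (suc t) j reach with bind-just⁻ (advance t fzero) nextPos (trans (sym (advance-suc t fzero)) reach)
      ... | (j₀ , reach₀ , step) = begin
        app α (p i j)                                   ≡⟨ cong (_>>= app α) (sym (trans (σ-on-paths i j₀) (cong (Maybe.map (p i)) step))) ⟩
        (app σ (p i j₀) >>= app α)                      ≡⟨ sym (commutes (p i j₀)) ⟩
        (app α (p i j₀) >>= app σ)                      ≡⟨ cong (_>>= app σ) (by-steps t j₀ reach₀) ⟩
        (Maybe.map (p i′) (advance t j′) >>= app σ)     ≡⟨ σ-after i′ (advance t j′) ⟩
        Maybe.map (p i′) (advance t j′ >>= nextPos)     ≡⟨ cong (Maybe.map (p i′)) (sym (advance-suc t j′)) ⟩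
        Maybe.map (p i′) (advance (suc t) j′)           ∎
        where open ≡-Reasoning

    α≡rootOf : α ≡ rootOf configOf
    α≡rootOf = pmap-ext α (rootOf configOf) λ i j →
      let (y₀ , e) = start-defined i
          entry : lookup configOf i ≡ (proj₁ (coords y₀) , toℕ (proj₂ (coords y₀)))
          entry = trans (lookup∘tabulate _ i) (cong (decode i) e) in
      trans (along-path i e j)
        (sym (trans (app-rootOf configOf i j) (cong (λ (v : Fin n × ℕ) → Maybe.map (p (proj₁ v)) (advance (proj₂ v) j)) entry)))

    -- α^k = σ moves p i 0 to p i 1, so the configuration is full.
    configOf-Full : Full configOf
    configOf-Full i with map-just⁻ (p (iter configOf k i)) (advance (drift configOf k i) fzero) power-at-start
      where
      power-at-start : Maybe.map (p (iter configOf k i)) (advance (drift configOf k i) fzero) ≡ just (p i (fsuc fzero))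
      power-at-start = trans (sym (app-rootOf-^ configOf k i fzero))
        (trans (cong (λ β → app (β ^ₚ k) (p i fzero)) (sym α≡rootOf))
          (trans (cong (λ β → app β (p i fzero)) α^k≡σ) (σ-on-paths i fzero)))
    ... | (u , reach , pu) with p-injective _ _ _ _ pu
    ...   | (back , refl) = back , trans (sym (+-identityʳ _)) (sym (advance-toℕ (drift configOf k i) fzero reach))

  roots : List (PMap m)
  roots = map rootOf fullConfigs

  roots-unique : Unique roots
  roots-unique = map-unique rootOf fullConfigs fullConfigs-unique
    (λ c c′ c∈ c′∈ → rootOf-injective c c′ (∈-fullConfigs⁻ c∈) (∈-fullConfigs⁻ c′∈))

  ∈-roots⇔IsRoot : ∀ α → (α ∈ roots) ⇔ IsRoot k σ α
  ∈-roots⇔IsRoot α = mk⇔ to from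
    where
    to : α ∈ roots → IsRoot k σ α
    to α∈ with ∈-map⁻ rootOf α∈
    ... | (c , c∈ , refl) = rootOf-IsRoot c (∈-fullConfigs⁻ c∈)
    from : IsRoot k σ α → α ∈ roots
    from root = subst (_∈ roots) (sym α≡rootOf) (∈-map⁺ rootOf (∈-fullConfigs⁺ configOf-Full))
      where open FromRoot α root

  length-roots : length roots ≡ count n n
  length-roots = trans (length-map rootOf fullConfigs) length-fullConfigs

proposition1 : (k : ℕ) → .{{_ : NonZero k}} → (m n ℓ : ℕ) → 1 < ℓ
    → (σ : PMap m) → IsSIM σ → (p : Fin n → Fin ℓ → Fin m) → IsProductOfPaths n ℓ σ p
    → ((∃[ α ] IsRoot k σ α) ⇔ (k ∣ n))
      × (k ∣ n → Σ (List (PMap m)) (λ roots →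
           Unique roots
           × (∀ α → (α ∈ roots ⇔ IsRoot k σ α))
           × (length roots ≡ (n ! / (n / k) !) {{(n / k) !≢0}})))
proposition1 zero m n ℓ _ σ _ p _ = ⊥-elim (≢-nonZero⁻¹ 0 refl)
proposition1 (suc k′) m n (suc (suc ℓ′)) (s≤s (s≤s z≤n)) σ _ p paths =
  mk⇔ root⇒k∣n k∣n⇒root , λ k∣n → roots , roots-unique , ∈-roots⇔IsRoot , length-formula k∣n
  where
  open Counting k′
  open Roots σ p paths
  open Function.Bundles.Equivalence using (to; from)

  count-formula : k ∣ n → count n n * (n / k) ! ≡ n !
  count-formula (divides q n≡q*k) =
    subst (λ N → count n N * (N / k) ! ≡ N !) (sym n≡q*k)
      (subst (λ r → count n (q * k) * r ! ≡ (q * k) !) (sym (m*n/n≡m q k)) (count-! q n (≤-reflexive (sym n≡q*k))))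

  -- A root makes the list of roots, hence count n n, nonzero; so k ∣ n.
  root⇒k∣n : ∃[ α ] IsRoot k σ α → k ∣ n
  root⇒k∣n (α , root) =
    count≢0⇒∣ n n (λ count≡0 → member⇒length≢0 roots (from (∈-roots⇔IsRoot α) root) (trans length-roots count≡0))

  -- If k ∣ n then count n n ≠ 0 since n! ≠ 0, so some root exists.
  k∣n⇒root : k ∣ n → ∃[ α ] IsRoot k σ α
  k∣n⇒root k∣n =
    let (α , α∈) = length≢0⇒member roots λ length≡0 →
                     ≢-nonZero⁻¹ (n !) {{n !≢0}} (trans (sym (count-formula k∣n))
                       (cong (_* (n / k) !) (trans (sym length-roots) length≡0))) in
    α , to (∈-roots⇔IsRoot α) α∈

  length-formula : (k∣n : k ∣ n) → length roots ≡ (n ! / (n / k) !) {{(n / k) !≢0}}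
  length-formula k∣n = trans length-roots (sym (trans (/-congˡ {{(n / k) !≢0}} (sym (count-formula k∣n)))
                                                       (m*n/n≡m (count n n) ((n / k) !) {{(n / k) !≢0}})))
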